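{- For $n\ge1$, the number $c(n)$ of connected solutions $(X,Y)\in T_n^2$ of the system $X^2=X$, $Y^2=Y$, $XY=YX$ is $$c(n)=\sum_{0\le r,s,t\le n}\frac{n!}{r!\,s!\,t!\,(n-r-s-t)!}\,r^{n-r-s-t}s^{n-r-s+1},$$ where $0^0=1$ and $1/m!=0$ for negative integers $m$ (so the sum is restricted to $r+s+t\le n$).
   Context: $T_n$ is the semigroup of all maps $[n]\to[n]$, $[n]=\{1,\dots,n\}$, with product $(\tau_1\cdot\tau_2)(j)=\tau_2(\tau_1(j))$. A pair $(X,Y)\in T_n^2$ is connected if the directed graph on $[n]$ with edges $j\to X(j)$ and $j\to Y(j)$ (for all $j$) is connected when edge directions are ignored. -}

module Defs where

open import Data.Nat using (ℕ; zero; suc; _+_; _*_; _∸_; _^_; _≤ᵇ_; NonZero)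
open import Data.Nat.Properties using (_!*_!≢0; m*n≢0)
open import Data.Nat using (_!)
open import Data.Nat.DivMod using (_/_)
open import Data.Bool using (if_then_else_)
open import Data.List using (List; map; upTo)
open import Data.Nat.ListAction using (sum)
open import Data.Fin using (Fin)
open import Data.Vec using (Vec; lookup)
open import Data.Product using (_×_; _,_)
open import Data.Sum using (_⊎_)
open import Relation.Binary.PropositionalEquality using (_≡_)
open import Relation.Binary.Construct.Closure.ReflexiveTransitive using (Star)

-- Elements of T_n : maps [n] → [n], represented as their table of values
-- (a vector of length n), so that equality of maps is decidable equality.
T : ℕ → Set
T n = Vec (Fin n) n

app : ∀ {n} → T n → Fin n → Fin n
app X j = lookup X j

-- X² = X, with (τ₁·τ₂)(j) = τ₂(τ₁(j))
Idempotent : ∀ {n} → T n → Set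
Idempotent X = ∀ j → app X (app X j) ≡ app X j

Commute : ∀ {n} → T n → T n → Set
Commute X Y = ∀ j → app Y (app X j) ≡ app X (app Y j)

Adj : ∀ {n} → T n → T n → Fin n → Fin n → Set
Adj X Y i k = (k ≡ app X i) ⊎ (i ≡ app X k) ⊎ (k ≡ app Y i) ⊎ (i ≡ app Y k)

Connected : ∀ {n} → T n → T n → Set
Connected X Y = ∀ i j → Star (Adj X Y) i j

ConnectedSolution : ∀ {n} → T n × T n → Set
ConnectedSolution (X , Y) =
  Idempotent X × Idempotent Y × Commute X Y × Connected X Y

multinomial : ℕ → ℕ → ℕ → ℕ → ℕ → ℕ
multinomial n r s t m =
  (n ! / ((r ! * s !) * (t ! * m !)))
    {{m*n≢0 (r ! * s !) (t ! * m !) {{r !* s !≢0}} {{t !* m !≢0}}}}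

Σ≤ : ℕ → (ℕ → ℕ) → ℕ
Σ≤ n f = sum (map f (upTo (suc n)))

-- the closed formula; terms with r+s+t > n vanish (1/m! = 0 for m < 0)
term : ℕ → ℕ → ℕ → ℕ → ℕ
term n r s t =
  if r + s + t ≤ᵇ n
  then multinomial n r s t (n ∸ r ∸ s ∸ t) * r ^ (n ∸ r ∸ s ∸ t) * s ^ (n ∸ r ∸ s + 1)
  else 0

formula : ℕ → ℕ
formula n = Σ≤ n λ r → Σ≤ n λ s → Σ≤ n λ t → term n r s t

{-# OPTIONS --safe #-}

-- In a connected solution (X , Y) the map j ↦ Y (X j) is constant, since it is invariant
-- along both kinds of edges; its value c, the centre, is fixed by X and by Y. Every point j
-- then lies in one of four classes: Y j = j (and X j = c); X j = j ≠ Y j (and Y j = c);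
-- X j = c ≠ j (and Y j is Y-fixed); or none of these (X j is X-fixed but not Y-fixed, and
-- Y j is Y-fixed). Conversely a labelling of the points by these classes, a Y-fixed centre
-- and images chosen as prescribed always give a connected solution, from which labelling
-- and centre are recovered. With r, s, t, m points in the four classes there are
-- n!/(r! s! t! m!) labellings, s centres, r^m maps X and s^(t+m) maps Y: the summand of c(n).

module Submission where

open import Defs
open import Data.Nat using (ℕ; _≥_)
open import Data.List using (List; length)
open import Data.List.Relation.Unary.Unique.Propositional using (Unique)
open import Data.List.Membership.Propositional using (_∈_)
open import Data.Product using (Σ; _×_)
open import Function.Bundles using (_⇔_)
open import Relation.Binary.PropositionalEquality using (_≡_)

open import Data.Bool using (true; false)
import Data.Bool as Bool
open import Data.Empty using (⊥)
open import Data.Fin using (Fin; zero; suc; punchIn; _≟_)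
open import Data.Fin.Properties using (punchInᵢ≢i)
open import Data.List as List
  using ([]; _∷_; _++_; [_]; map; concatMap; allFin; upTo; filter; cartesianProduct; cartesianProductWith)
open import Data.List.Membership.Propositional using (find; lose)
open import Data.List.Membership.Propositional.Properties
  using ( ∈-concatMap⁻; ∈-concatMap⁺; ∈-map⁻; ∈-map⁺; ∈-allFin; ∈-upTo⁺; ∈-filter⁺; ∈-filter⁻
        ; ∈-cartesianProduct⁺; ∈-cartesianProduct⁻; ∈-cartesianProductWith⁺; ∈-cartesianProductWith⁻)
open import Data.List.Properties using (length-++; length-map; map-++; map-∘; map-cong; filter-accept)
open import Data.List.Relation.Unary.All as All using ([])
open import Data.List.Relation.Unary.AllPairs using ([]; _∷_)
open import Data.List.Relation.Unary.Any using (here; there)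
open import Data.List.Relation.Unary.Any.Properties using (singleton⁻)
open import Data.List.Relation.Unary.Unique.Propositional.Properties
  using (++⁺; map⁺; allFin⁺; upTo⁺; filter⁺; cartesianProduct⁺; cartesianProductWith⁺)
open import Data.Nat using (zero; suc; s≤s; _+_; _*_; _^_; _∸_; _≤_; _≤ᵇ_; _!; NonZero)
open import Data.Nat.DivMod using (_/_; m*n/n≡m)
open import Data.Nat.ListAction using (sum)
open import Data.Nat.ListAction.Properties using (sum-++)
open import Data.Nat.Properties
  using ( +-0-commutativeMonoid; *-1-commutativeMonoid; +-*-semiring; *-commutativeSemigroup
        ; *-assoc; +-identityʳ; *-identityˡ; *-identityʳ; ^-zeroˡ; ^-distribˡ-+-*; suc-injective
        ; m+n≡0⇒m≡0; m+n≡0⇒n≡0; m+n∸m≡n; ∸-+-assoc; m+[n∸m]≡n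
        ; ≤ᵇ⇒≤; ≤⇒≤ᵇ; ≤-trans; ≤-reflexive; m≤m+n; m*n≢0; _!*_!≢0)
import Data.Nat.Properties as ℕ
open import Data.Nat.Tactic.RingSolver using (solve-∀)
open import Data.Product using (_,_; proj₁; proj₂)
open import Data.Sum using (inj₁; inj₂)
open import Data.Unit using (tt)
open import Data.Vec as Vec using (Vec; []; _∷_; head; lookup; tabulate; count; replicate; updateAt; _[_]≔_; _[_]%=_)
open import Data.Vec.Functional using (removeAt)
open import Data.Vec.Properties
  using ( ∷-injective; ∷-injectiveʳ; ≡-dec; count≤n; lookup∘updateAt; lookup∘updateAt′; lookup-replicate
        ; []≔-lookup; []%=-∘; lookup∘tabulate; tabulate∘lookup; tabulate-cong)
open import Function using (_∘_; id)
open import Function.Bundles using (mk⇔)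
open import Level using (0ℓ)
open import Relation.Binary.Construct.Closure.ReflexiveTransitive using (Star; ε; _◅_; _◅◅_)
open import Relation.Binary.PropositionalEquality
  using (_≢_; _≗_; refl; sym; trans; cong; cong₂; subst; module ≡-Reasoning)
open import Relation.Nullary using (Dec; does; yes; no; ¬_; contradiction)
open import Relation.Unary using (Pred; Decidable)
open import Algebra.Properties.CommutativeMonoid.Sum +-0-commutativeMonoid
  using () renaming (sum to ∑; sum-remove to ∑-remove; sum-cong-≗ to ∑-cong; sum-replicate-zero to ∑-zero)
open import Algebra.Properties.CommutativeMonoid.Sum *-1-commutativeMonoid
  using () renaming (sum to ∏; sum-remove to ∏-remove; sum-cong-≗ to ∏-cong; sum-replicate-zero to ∏-one)
open import Algebra.Properties.CommutativeSemigroup *-commutativeSemigroup using (x∙yz≈y∙xz)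
open import Algebra.Properties.Semiring.Sum +-*-semiring using (*-distribʳ-sum)

private variable
  A B C : Set
  a k n : ℕ

length-cartesianProductWith : (f : A → B → C) (xs : List A) (ys : List B) →
  length (cartesianProductWith f xs ys) ≡ length xs * length ys
length-cartesianProductWith f []       ys = refl
length-cartesianProductWith f (x ∷ xs) ys = begin
  length (map (f x) ys ++ cartesianProductWith f xs ys)
    ≡⟨ length-++ (map (f x) ys) ⟩
  length (map (f x) ys) + length (cartesianProductWith f xs ys)
    ≡⟨ cong₂ _+_ (length-map (f x) ys) (length-cartesianProductWith f xs ys) ⟩
  length ys + length xs * length ys ∎
  where open ≡-Reasoning

length-concatMap : (f : A → List B) (xs : List A) →
  length (concatMap f xs) ≡ sum (map (length ∘ f) xs)
length-concatMap f []       = refl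
length-concatMap f (x ∷ xs) =
  trans (length-++ (f x)) (cong (length (f x) +_) (length-concatMap f xs))

length-concatMap-tabulate : (f : A → List B) (g : Fin k → A) →
  length (concatMap f (List.tabulate g)) ≡ ∑ (length ∘ f ∘ g)
length-concatMap-tabulate {k = zero}  f g = refl
length-concatMap-tabulate {k = suc k} f g =
  trans (length-++ (f (g zero))) (cong (length (f (g zero)) +_) (length-concatMap-tabulate f (g ∘ suc)))

length-concatMap-uniform : (f : A → List B) (xs : List A) →
  (∀ {x} → x ∈ xs → length (f x) ≡ k) → length (concatMap f xs) ≡ length xs * k
length-concatMap-uniform f []       eq = refl
length-concatMap-uniform f (x ∷ xs) eq =
  trans (length-++ (f x)) (cong₂ _+_ (eq (here refl)) (length-concatMap-uniform f xs (eq ∘ there)))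

sum-map-cartesianProduct : (g : A × B → ℕ) (xs : List A) (ys : List B) →
  sum (map g (cartesianProduct xs ys)) ≡ sum (map (λ x → sum (map (λ y → g (x , y)) ys)) xs)
sum-map-cartesianProduct g []       ys = refl
sum-map-cartesianProduct g (x ∷ xs) ys = begin
  sum (map g (map (x ,_) ys ++ cartesianProduct xs ys))
    ≡⟨ cong sum (map-++ g (map (x ,_) ys) _) ⟩
  sum (map g (map (x ,_) ys) ++ map g (cartesianProduct xs ys))
    ≡⟨ sum-++ (map g (map (x ,_) ys)) _ ⟩
  sum (map g (map (x ,_) ys)) + sum (map g (cartesianProduct xs ys))
    ≡⟨ cong₂ _+_ (cong sum (sym (map-∘ ys))) (sum-map-cartesianProduct g xs ys) ⟩
  sum (map (λ y → g (x , y)) ys) + sum (map (λ x → sum (map (λ y → g (x , y)) ys)) xs) ∎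
  where open ≡-Reasoning

concatMap-unique : {f : A → List B} (key : B → A) {xs : List A} → Unique xs →
  (∀ {x} → x ∈ xs → Unique (f x)) → (∀ {x b} → x ∈ xs → b ∈ f x → key b ≡ x) →
  Unique (concatMap f xs)
concatMap-unique key []              uf kf = []
concatMap-unique {f = f} key {x ∷ xs} (x∉xs ∷ uxs) uf kf =
  ++⁺ (uf (here refl)) (concatMap-unique key uxs (uf ∘ there) (kf ∘ there)) disjoint
  where
  disjoint : ∀ {b} → b ∈ f x × b ∈ concatMap f xs → ⊥
  disjoint (b∈fx , b∈rest) with y , y∈xs , b∈fy ← find (∈-concatMap⁻ f b∈rest) =
    All.lookup x∉xs y∈xs (trans (sym (kf (here refl) b∈fx)) (kf (there y∈xs) b∈fy))

length-filter-tabulate : {P : Pred B 0ℓ} (P? : Decidable P) (f : A → B) (g : Fin k → A) →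
  length (filter (P? ∘ f) (List.tabulate g)) ≡ count P? (Vec.tabulate (f ∘ g))
length-filter-tabulate {k = zero}  P? f g = refl
length-filter-tabulate {k = suc k} P? f g with does (P? (f (g zero)))
... | true  = cong suc (length-filter-tabulate P? f (g ∘ suc))
... | false = length-filter-tabulate P? f (g ∘ suc)

choices : (Fin k → List A) → List (Vec A k)
choices {k = zero}  S = [ [] ]
choices {k = suc k} S = cartesianProductWith _∷_ (S zero) (choices (S ∘ suc))

∈-choices⁺ : {S : Fin k → List A} {v : Vec A k} → (∀ j → lookup v j ∈ S j) → v ∈ choices S
∈-choices⁺ {v = []}    v∈S = here refl
∈-choices⁺ {v = x ∷ v} v∈S = ∈-cartesianProductWith⁺ _∷_ (v∈S zero) (∈-choices⁺ (v∈S ∘ suc))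

∈-choices⁻ : {S : Fin k → List A} {v : Vec A k} → v ∈ choices S → ∀ j → lookup v j ∈ S j
∈-choices⁻ {k = suc k} {S = S} v∈
  with x , w , x∈ , w∈ , refl ← ∈-cartesianProductWith⁻ _∷_ (S zero) (choices (S ∘ suc)) v∈
  = λ { zero → x∈ ; (suc j) → ∈-choices⁻ w∈ j }

choices-unique : {S : Fin k → List A} → (∀ j → Unique (S j)) → Unique (choices S)
choices-unique {k = zero}  uS = [] ∷ []
choices-unique {k = suc k} uS = cartesianProductWith⁺ _∷_ ∷-injective (uS zero) (choices-unique (uS ∘ suc))

length-choices : (S : Fin k → List A) → length (choices S) ≡ ∏ (length ∘ S)
length-choices {k = zero}  S = refl
length-choices {k = suc k} S =
  trans (length-cartesianProductWith _∷_ (S zero) _) (cong (length (S zero) *_) (length-choices (S ∘ suc)))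

-- Words and letter multiplicities

removeAt-updateAt : (κ : Vec A (suc a)) (x : Fin (suc a)) {h : A → A} →
  removeAt (lookup (updateAt κ x h)) x ≗ removeAt (lookup κ) x
removeAt-updateAt κ x i = lookup∘updateAt′ (punchIn x i) x (punchInᵢ≢i x i) κ

∑-%=suc : (κ : Vec ℕ (suc a)) (x : Fin (suc a)) → ∑ (lookup (κ [ x ]%= suc)) ≡ suc (∑ (lookup κ))
∑-%=suc κ x = begin
  ∑ (lookup (κ [ x ]%= suc))
    ≡⟨ ∑-remove {i = x} (lookup (κ [ x ]%= suc)) ⟩
  lookup (κ [ x ]%= suc) x + ∑ (removeAt (lookup (κ [ x ]%= suc)) x)
    ≡⟨ cong₂ _+_ (lookup∘updateAt x κ) (∑-cong (removeAt-updateAt κ x)) ⟩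
  suc (lookup κ x + ∑ (removeAt (lookup κ) x))
    ≡⟨ cong suc (∑-remove {i = x} (lookup κ)) ⟨
  suc (∑ (lookup κ)) ∎
  where open ≡-Reasoning

∏-%=suc : (g : Fin (suc a) → ℕ → ℕ) (q : ℕ → ℕ) (κ : Vec ℕ (suc a)) (x : Fin (suc a)) →
  (∀ k → g x (suc k) ≡ q k * g x k) →
  ∏ (λ y → g y (lookup (κ [ x ]%= suc) y)) ≡ q (lookup κ x) * ∏ (λ y → g y (lookup κ y))
∏-%=suc {a} g q κ x g-step = begin
  ∏ G′
    ≡⟨ ∏-remove {i = x} G′ ⟩
  G′ x * ∏ (removeAt G′ x)
    ≡⟨ cong₂ _*_ G′x≡ (∏-cong (λ i → cong (g (punchIn x i)) (removeAt-updateAt κ x i))) ⟩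
  q (lookup κ x) * G x * ∏ (removeAt G x)
    ≡⟨ *-assoc (q (lookup κ x)) (G x) _ ⟩
  q (lookup κ x) * (G x * ∏ (removeAt G x))
    ≡⟨ cong (q (lookup κ x) *_) (∏-remove {i = x} G) ⟨
  q (lookup κ x) * ∏ G ∎
  where
  open ≡-Reasoning
  G G′ : Fin (suc a) → ℕ
  G  y = g y (lookup κ y)
  G′ y = g y (lookup (κ [ x ]%= suc) y)
  G′x≡ : G′ x ≡ q (lookup κ x) * G x
  G′x≡ = trans (cong (g x) (lookup∘updateAt x κ)) (g-step (lookup κ x))

census : Vec (Fin a) n → Vec ℕ a
census []      = replicate _ 0
census (x ∷ ℓ) = census ℓ [ x ]%= suc

lookup-census : (ℓ : Vec (Fin a) n) (x : Fin a) → lookup (census ℓ) x ≡ count (_≟ x) ℓ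
lookup-census []      x = lookup-replicate x 0
lookup-census (y ∷ ℓ) x with y ≟ x
... | yes refl = trans (lookup∘updateAt x (census ℓ)) (cong suc (lookup-census ℓ x))
... | no y≢x   = trans (lookup∘updateAt′ x y (y≢x ∘ sym) (census ℓ)) (lookup-census ℓ x)

∑-census : (ℓ : Vec (Fin a) n) → ∑ (lookup (census ℓ)) ≡ n
∑-census {a} []  = trans (∑-cong {a} (λ x → lookup-replicate x 0)) (∑-zero a)
∑-census {suc a} (x ∷ ℓ) = trans (∑-%=suc (census ℓ) x) (cong suc (∑-census ℓ))

positions : Fin a → Vec (Fin a) k → List (Fin k)
positions x ℓ = filter (λ j → lookup ℓ j ≟ x) (allFin _)

∈-positions⁺ : {x : Fin a} (ℓ : Vec (Fin a) k) {j : Fin k} → lookup ℓ j ≡ x → j ∈ positions x ℓ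
∈-positions⁺ {x = x} ℓ {j} = ∈-filter⁺ (λ j → lookup ℓ j ≟ x) (∈-allFin j)

∈-positions⁻ : {x : Fin a} (ℓ : Vec (Fin a) k) {j : Fin k} → j ∈ positions x ℓ → lookup ℓ j ≡ x
∈-positions⁻ {k = k} {x = x} ℓ = proj₂ ∘ ∈-filter⁻ (λ j → lookup ℓ j ≟ x) {xs = allFin k}

positions-unique : (x : Fin a) (ℓ : Vec (Fin a) k) → Unique (positions x ℓ)
positions-unique x ℓ = filter⁺ (λ j → lookup ℓ j ≟ x) (allFin⁺ _)

length-positions : (x : Fin a) (ℓ : Vec (Fin a) k) → length (positions x ℓ) ≡ lookup (census ℓ) x
length-positions x ℓ = begin
  length (positions x ℓ)                 ≡⟨ length-filter-tabulate (_≟ x) (lookup ℓ) id ⟩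
  count (_≟ x) (Vec.tabulate (lookup ℓ)) ≡⟨ cong (count (_≟ x)) (tabulate∘lookup ℓ) ⟩
  count (_≟ x) ℓ                         ≡⟨ lookup-census ℓ x ⟨
  lookup (census ℓ) x ∎
  where open ≡-Reasoning

∏-lookup : (f : Fin a → ℕ) (ℓ : Vec (Fin a) k) → ∏ (f ∘ lookup ℓ) ≡ ∏ (λ x → f x ^ lookup (census ℓ) x)
∏-lookup {a} f [] = sym (trans (∏-cong {a} (λ x → cong (f x ^_) (lookup-replicate x 0))) (∏-one a))
∏-lookup {suc a} f (y ∷ ℓ) = begin
  f y * ∏ (f ∘ lookup ℓ)
    ≡⟨ cong (f y *_) (∏-lookup f ℓ) ⟩
  f y * ∏ (λ x → f x ^ lookup (census ℓ) x)
    ≡⟨ ∏-%=suc (λ x k → f x ^ k) (λ _ → f y) (census ℓ) y (λ _ → refl) ⟨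
  ∏ (λ x → f x ^ lookup (census (y ∷ ℓ)) x) ∎
  where open ≡-Reasoning

withHead : Fin a → ℕ → (ℕ → List (Vec (Fin a) n)) → List (Vec (Fin a) (suc n))
withHead x zero    ws = []
withHead x (suc j) ws = map (x ∷_) (ws j)

∈-withHead⁺ : {x : Fin a} {k j : ℕ} {ws : ℕ → List (Vec (Fin a) n)} {w : Vec (Fin a) n} →
  k ≡ suc j → w ∈ ws j → x ∷ w ∈ withHead x k ws
∈-withHead⁺ refl w∈ = ∈-map⁺ _ w∈

∈-withHead⁻ : (x : Fin a) (k : ℕ) (ws : ℕ → List (Vec (Fin a) n)) {v : Vec (Fin a) (suc n)} →
  v ∈ withHead x k ws → Σ ℕ λ j → k ≡ suc j × Σ (Vec (Fin a) n) λ w → v ≡ x ∷ w × w ∈ ws j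
∈-withHead⁻ x (suc j) ws v∈ with w , w∈ , refl ← ∈-map⁻ (x ∷_) v∈ = j , refl , w , refl , w∈

withHead-unique : (x : Fin a) (k : ℕ) {ws : ℕ → List (Vec (Fin a) n)} →
  (∀ j → Unique (ws j)) → Unique (withHead x k ws)
withHead-unique x zero    u = []
withHead-unique x (suc j) u = map⁺ ∷-injectiveʳ (u j)

hasCensus? : (κ : Vec ℕ a) (w : Vec (Fin a) n) → Dec (census w ≡ κ)
hasCensus? κ w = ≡-dec ℕ._≟_ (census w) κ

arrangements : (n : ℕ) → Vec ℕ a → List (Vec (Fin a) n)
arrangements zero    κ = filter (hasCensus? κ) [ [] ]
arrangements (suc n) κ =
  concatMap (λ x → withHead x (lookup κ x) (λ j → arrangements n (κ [ x ]≔ j))) (allFin _)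

increment∘decrement : (κ : Vec ℕ a) (x : Fin a) {j : ℕ} → lookup κ x ≡ suc j → (κ [ x ]≔ j) [ x ]%= suc ≡ κ
increment∘decrement κ x κx≡1+j = begin
  (κ [ x ]≔ _) [ x ]%= suc  ≡⟨ []%=-∘ κ x ⟩
  κ [ x ]≔ suc _            ≡⟨ cong (κ [ x ]≔_) κx≡1+j ⟨
  κ [ x ]≔ lookup κ x       ≡⟨ []≔-lookup κ x ⟩
  κ ∎
  where open ≡-Reasoning

∈-arrangements⁻ : ∀ n (κ : Vec ℕ a) {ℓ} → ℓ ∈ arrangements n κ → census ℓ ≡ κ
∈-arrangements⁻ zero    κ ℓ∈ = proj₂ (∈-filter⁻ (hasCensus? κ) {xs = [ [] ]} ℓ∈)
∈-arrangements⁻ (suc n) κ ℓ∈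
  with x , _ , ℓ∈x ← find (∈-concatMap⁻ _ {xs = allFin _} ℓ∈)
  with j , κx≡1+j , w , refl , w∈ ← ∈-withHead⁻ x (lookup κ x) _ ℓ∈x
  = trans (cong (_[ x ]%= suc) (∈-arrangements⁻ n _ w∈)) (increment∘decrement κ x κx≡1+j)

∈-arrangements⁺ : (ℓ : Vec (Fin a) n) → ℓ ∈ arrangements n (census ℓ)
∈-arrangements⁺ []      = ∈-filter⁺ (hasCensus? (census [])) (here refl) refl
∈-arrangements⁺ (x ∷ ℓ) = ∈-concatMap⁺ _ (lose (∈-allFin x)
  (∈-withHead⁺ (lookup∘updateAt x (census ℓ))
    (subst (ℓ ∈_) (cong (arrangements _) restored) (∈-arrangements⁺ ℓ))))
  where
  restored : census ℓ ≡ census (x ∷ ℓ) [ x ]≔ lookup (census ℓ) x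
  restored = sym (trans ([]%=-∘ (census ℓ) x) ([]≔-lookup (census ℓ) x))

arrangements-unique : ∀ n (κ : Vec ℕ a) → Unique (arrangements n κ)
arrangements-unique zero    κ = filter⁺ (hasCensus? κ) {xs = [ [] ]} ([] ∷ [])
arrangements-unique (suc n) κ = concatMap-unique head (allFin⁺ _)
  (λ {x} _ → withHead-unique x (lookup κ x) (λ j → arrangements-unique n _))
  (λ {x} _ → headIs x)
  where
  headIs : ∀ x {v} → v ∈ withHead x (lookup κ x) (λ j → arrangements n (κ [ x ]≔ j)) → head v ≡ x
  headIs x v∈ with _ , _ , _ , refl , _ ← ∈-withHead⁻ x (lookup κ x) _ v∈ = refl

∑≡0⇒replicate : (κ : Vec ℕ a) → ∑ (lookup κ) ≡ 0 → κ ≡ replicate a 0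
∑≡0⇒replicate []      _ = refl
∑≡0⇒replicate (v ∷ κ) e = cong₂ _∷_ (m+n≡0⇒m≡0 v e) (∑≡0⇒replicate κ (m+n≡0⇒n≡0 v e))

factorialProduct : Vec ℕ a → ℕ
factorialProduct κ = ∏ (λ x → lookup κ x !)

length-arrangements : ∀ n (κ : Vec ℕ a) → ∑ (lookup κ) ≡ n →
  length (arrangements n κ) * factorialProduct κ ≡ n !
length-arrangements {a} zero κ ∑κ≡0 with refl ← ∑≡0⇒replicate κ ∑κ≡0 =
  cong₂ (λ ws p → length ws * p) (filter-accept (hasCensus? (replicate a 0)) {x = []} {xs = []} refl)
    (trans (∏-cong {a} (λ x → cong _! (lookup-replicate x 0))) (∏-one a))
length-arrangements {zero}  (suc n) [] ()
length-arrangements {suc a} (suc n) κ ∑κ≡1+n = begin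
  length (concatMap byHead (allFin _)) * F  ≡⟨ cong (_* F) (length-concatMap-tabulate byHead id) ⟩
  ∑ (length ∘ byHead) * F                   ≡⟨ *-distribʳ-sum F (length ∘ byHead) ⟩
  ∑ (λ x → length (byHead x) * F)           ≡⟨ ∑-cong byHead-length ⟩
  ∑ (λ x → lookup κ x * n !)                ≡⟨ *-distribʳ-sum (n !) (lookup κ) ⟨
  ∑ (lookup κ) * n !                        ≡⟨ cong (_* n !) ∑κ≡1+n ⟩
  suc n * n ! ∎
  where
  open ≡-Reasoning
  F = factorialProduct κ
  byHead : Fin (suc a) → List (Vec (Fin (suc a)) (suc n))
  byHead x = withHead x (lookup κ x) (λ j → arrangements n (κ [ x ]≔ j))

  byHead-length : ∀ x → length (byHead x) * F ≡ lookup κ x * n !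
  byHead-length x with lookup κ x in κx≡k
  ... | zero  = refl
  ... | suc j = begin
    length (map (x ∷_) (arrangements n κ′)) * F
      ≡⟨ cong₂ _*_ (length-map (x ∷_) (arrangements n κ′)) F≡1+j*F′ ⟩
    length (arrangements n κ′) * (suc j * F′)
      ≡⟨ x∙yz≈y∙xz (length (arrangements n κ′)) (suc j) F′ ⟩
    suc j * (length (arrangements n κ′) * F′)
      ≡⟨ cong (suc j *_) (length-arrangements n κ′ ∑κ′≡n) ⟩
    suc j * n ! ∎
    where
    κ′ = κ [ x ]≔ j
    F′ = factorialProduct κ′
    restored : κ′ [ x ]%= suc ≡ κ
    restored = increment∘decrement κ x κx≡k
    F≡1+j*F′ : F ≡ suc j * F′
    F≡1+j*F′ = begin
      F                                  ≡⟨ cong factorialProduct restored ⟨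
      factorialProduct (κ′ [ x ]%= suc)  ≡⟨ ∏-%=suc (λ _ k → k !) suc κ′ x (λ _ → refl) ⟩
      suc (lookup κ′ x) * F′             ≡⟨ cong (λ k → suc k * F′) (lookup∘updateAt x κ) ⟩
      suc j * F′ ∎
    ∑κ′≡n : ∑ (lookup κ′) ≡ n
    ∑κ′≡n = suc-injective (trans (sym (∑-%=suc κ′ x)) (trans (cong (∑ ∘ lookup) restored) ∑κ≡1+n))

arrangements-empty : ∀ n (κ : Vec ℕ a) → ∑ (lookup κ) ≢ n → arrangements n κ ≡ []
arrangements-empty n κ ∑κ≢n with arrangements n κ in eq
... | []    = refl
... | ℓ ∷ _ = contradiction ∑κ≡n ∑κ≢n
  where
  ∑κ≡n : ∑ (lookup κ) ≡ n
  ∑κ≡n = trans (cong (∑ ∘ lookup) (sym (∈-arrangements⁻ n κ (subst (ℓ ∈_) (sym eq) (here refl)))))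
               (∑-census ℓ)

-- Connected pairs of commuting idempotents

module _ (X Y : T n) where

  YX-constant⇒connected : ∀ {c} → (∀ j → app Y (app X j) ≡ c) → Connected X Y
  YX-constant⇒connected YX≡c i j = intoCentre i ◅◅ outOfCentre j
    where
    intoCentre : ∀ i → Star (Adj X Y) i _
    intoCentre i = inj₁ refl ◅ inj₂ (inj₂ (inj₁ (sym (YX≡c i)))) ◅ ε
    outOfCentre : ∀ j → Star (Adj X Y) _ j
    outOfCentre j = inj₂ (inj₂ (inj₂ (sym (YX≡c j)))) ◅ inj₂ (inj₁ refl) ◅ ε

  connected⇒YX-constant : Idempotent X → Idempotent Y → Commute X Y → Connected X Y →
    ∀ i j → app Y (app X i) ≡ app Y (app X j)
  connected⇒YX-constant idX idY comm conn i j = along (conn i j)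
    where
    Z : Fin n → Fin n
    Z j = app Y (app X j)
    Z∘X : ∀ j → Z (app X j) ≡ Z j
    Z∘X j = cong (app Y) (idX j)
    Z∘Y : ∀ j → Z (app Y j) ≡ Z j
    Z∘Y j = trans (cong (app Y) (sym (comm j))) (idY (app X j))
    step : ∀ {i k} → Adj X Y i k → Z i ≡ Z k
    step {i} (inj₁ refl)                 = sym (Z∘X i)
    step {k = k} (inj₂ (inj₁ refl))      = Z∘X k
    step {i} (inj₂ (inj₂ (inj₁ refl)))   = sym (Z∘Y i)
    step {k = k} (inj₂ (inj₂ (inj₂ refl))) = Z∘Y k
    along : ∀ {i k} → Star (Adj X Y) i k → Z i ≡ Z k
    along ε       = refl
    along (a ◅ p) = trans (step a) (along p)

-- Labelled solutions

-- Labels form Fin 4 so that the lemmas on words over an alphabet Fin a apply. fixedX marks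
-- the X-fixed points that are not Y-fixed; the four labels are counted by the r, s, t and
-- m = n ∸ r ∸ s ∸ t of formula.
Label : Set
Label = Fin 4

pattern fixedX   = zero
pattern fixedY   = suc zero
pattern toCentre = suc (suc zero)
pattern other    = suc (suc (suc zero))

Rule : Vec Label n → Fin n → Label → (j x y : Fin n) → Set
Rule ℓ c fixedX   j x y = x ≡ j × y ≡ c
Rule ℓ c fixedY   j x y = x ≡ c × y ≡ j
Rule ℓ c toCentre j x y = x ≡ c × lookup ℓ y ≡ fixedY
Rule ℓ c other    j x y = lookup ℓ x ≡ fixedX × lookup ℓ y ≡ fixedY

record Admissible (ℓ : Vec Label n) (c : Fin n) (p : T n × T n) : Set where
  constructor admissible
  field
    centre-fixedY : lookup ℓ c ≡ fixedY
    rule          : ∀ j → Rule ℓ c (lookup ℓ j) j (app (proj₁ p) j) (app (proj₂ p) j)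

labels≢⇒≢ : (ℓ : Vec Label n) {i k : Fin n} {L L′ : Label} →
  lookup ℓ i ≡ L → lookup ℓ k ≡ L′ → L ≢ L′ → i ≢ k
labels≢⇒≢ ℓ ℓi ℓk L≢L′ refl = L≢L′ (trans (sym ℓi) ℓk)

module Admissibility {ℓ : Vec Label n} {c : Fin n} {X Y : T n} (adm : Admissible ℓ c (X , Y)) where
  open Admissible adm renaming (centre-fixedY to ℓc)

  point : ∀ j → Σ Label λ L → lookup ℓ j ≡ L × Rule ℓ c L j (app X j) (app Y j)
  point j = lookup ℓ j , refl , rule j

  fixedX-point : ∀ {k} → lookup ℓ k ≡ fixedX → app X k ≡ k × app Y k ≡ c
  fixedX-point {k} ℓk = subst (λ L → Rule ℓ c L k (app X k) (app Y k)) ℓk (rule k)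

  fixedY-point : ∀ {k} → lookup ℓ k ≡ fixedY → app X k ≡ c × app Y k ≡ k
  fixedY-point {k} ℓk = subst (λ L → Rule ℓ c L k (app X k) (app Y k)) ℓk (rule k)

  Xc≡c : app X c ≡ c
  Xc≡c = proj₁ (fixedY-point ℓc)

  Yc≡c : app Y c ≡ c
  Yc≡c = proj₂ (fixedY-point ℓc)

  YX≡c : ∀ j → app Y (app X j) ≡ c
  YX≡c j with point j
  ... | fixedX   , _ , Xj≡j , Yj≡c = trans (cong (app Y) Xj≡j) Yj≡c
  ... | fixedY   , _ , Xj≡c , _    = trans (cong (app Y) Xj≡c) Yc≡c
  ... | toCentre , _ , Xj≡c , _    = trans (cong (app Y) Xj≡c) Yc≡c
  ... | other    , _ , ℓXj  , _    = proj₂ (fixedX-point ℓXj)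

  XY≡c : ∀ j → app X (app Y j) ≡ c
  XY≡c j with point j
  ... | fixedX   , _ , _    , Yj≡c = trans (cong (app X) Yj≡c) Xc≡c
  ... | fixedY   , _ , Xj≡c , Yj≡j = trans (cong (app X) Yj≡j) Xj≡c
  ... | toCentre , _ , _    , ℓYj  = proj₁ (fixedY-point ℓYj)
  ... | other    , _ , _    , ℓYj  = proj₁ (fixedY-point ℓYj)

  idempotentX : Idempotent X
  idempotentX j with point j
  ... | fixedX   , _ , Xj≡j , _ = cong (app X) Xj≡j
  ... | fixedY   , _ , Xj≡c , _ = trans (cong (app X) Xj≡c) (trans Xc≡c (sym Xj≡c))
  ... | toCentre , _ , Xj≡c , _ = trans (cong (app X) Xj≡c) (trans Xc≡c (sym Xj≡c))
  ... | other    , _ , ℓXj  , _ = proj₁ (fixedX-point ℓXj)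

  idempotentY : Idempotent Y
  idempotentY j with point j
  ... | fixedX   , _ , _ , Yj≡c = trans (cong (app Y) Yj≡c) (trans Yc≡c (sym Yj≡c))
  ... | fixedY   , _ , _ , Yj≡j = cong (app Y) Yj≡j
  ... | toCentre , _ , _ , ℓYj  = proj₂ (fixedY-point ℓYj)
  ... | other    , _ , _ , ℓYj  = proj₂ (fixedY-point ℓYj)

  solution : ConnectedSolution (X , Y)
  solution = idempotentX , idempotentY , (λ j → trans (YX≡c j) (sym (XY≡c j))) , YX-constant⇒connected X Y YX≡c

classify : T n → T n → Fin n → Fin n → Label
classify X Y c j with app Y j ≟ j | app X j ≟ j | app X j ≟ c
... | yes _ | _     | _     = fixedY
... | no _  | yes _ | _     = fixedX
... | no _  | no _  | yes _ = toCentre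
... | no _  | no _  | no _  = other

module _ (X Y : T n) {c j : Fin n} where

  classify-fixedY : app Y j ≡ j → classify X Y c j ≡ fixedY
  classify-fixedY Yj≡j with app Y j ≟ j
  ... | yes _   = refl
  ... | no Yj≢j = contradiction Yj≡j Yj≢j

  classify-fixedX : app Y j ≢ j → app X j ≡ j → classify X Y c j ≡ fixedX
  classify-fixedX Yj≢j Xj≡j with app Y j ≟ j | app X j ≟ j
  ... | yes Yj≡j | _       = contradiction Yj≡j Yj≢j
  ... | no _     | yes _   = refl
  ... | no _     | no Xj≢j = contradiction Xj≡j Xj≢j

  classify-toCentre : app Y j ≢ j → app X j ≢ j → app X j ≡ c → classify X Y c j ≡ toCentre
  classify-toCentre Yj≢j Xj≢j Xj≡c with app Y j ≟ j | app X j ≟ j | app X j ≟ c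
  ... | yes Yj≡j | _        | _       = contradiction Yj≡j Yj≢j
  ... | no _     | yes Xj≡j | _       = contradiction Xj≡j Xj≢j
  ... | no _     | no _     | yes _   = refl
  ... | no _     | no _     | no Xj≢c = contradiction Xj≡c Xj≢c

  classify-other : app Y j ≢ j → app X j ≢ j → app X j ≢ c → classify X Y c j ≡ other
  classify-other Yj≢j Xj≢j Xj≢c with app Y j ≟ j | app X j ≟ j | app X j ≟ c
  ... | yes Yj≡j | _        | _        = contradiction Yj≡j Yj≢j
  ... | no _     | yes Xj≡j | _        = contradiction Xj≡j Xj≢j
  ... | no _     | no _     | yes Xj≡c = contradiction Xj≡c Xj≢c
  ... | no _     | no _     | no _     = refl

classify-admissible : {ℓ : Vec Label n} {c : Fin n} {X Y : T n} → Admissible ℓ c (X , Y) →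
  ∀ j → classify X Y c j ≡ lookup ℓ j
classify-admissible {ℓ = ℓ} {X = X} {Y} adm@(admissible ℓc _) j with Admissibility.point adm j
... | fixedX , ℓj , Xj≡j , Yj≡c = trans
  (classify-fixedX X Y (labels≢⇒≢ ℓ ℓc ℓj (λ ()) ∘ trans (sym Yj≡c)) Xj≡j)
  (sym ℓj)
... | fixedY , ℓj , _ , Yj≡j = trans
  (classify-fixedY X Y Yj≡j)
  (sym ℓj)
... | toCentre , ℓj , Xj≡c , ℓYj = trans
  (classify-toCentre X Y (labels≢⇒≢ ℓ ℓYj ℓj (λ ())) (labels≢⇒≢ ℓ ℓc ℓj (λ ()) ∘ trans (sym Xj≡c)) Xj≡c)
  (sym ℓj)
... | other , ℓj , ℓXj , ℓYj = trans
  (classify-other X Y (labels≢⇒≢ ℓ ℓYj ℓj (λ ())) (labels≢⇒≢ ℓ ℓXj ℓj (λ ())) (labels≢⇒≢ ℓ ℓXj ℓc (λ ())))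
  (sym ℓj)

module Classification (o : Fin n) where

  -- By connected⇒YX-constant, any base point o yields the centre of a connected solution.
  centre : T n × T n → Fin n
  centre (X , Y) = app Y (app X o)

  labelling : T n × T n → Vec Label n
  labelling (X , Y) = tabulate (classify X Y (centre (X , Y)))

  admissible⇒centre : ∀ {ℓ c p} → Admissible ℓ c p → centre p ≡ c
  admissible⇒centre {p = X , Y} adm = Admissibility.YX≡c adm o

  admissible⇒labelling : ∀ {ℓ c p} → Admissible ℓ c p → labelling p ≡ ℓ
  admissible⇒labelling {ℓ} {p = X , Y} adm = begin
    tabulate (classify X Y (centre (X , Y)))  ≡⟨ cong (tabulate ∘ classify X Y) (admissible⇒centre adm) ⟩
    tabulate (classify X Y _)                 ≡⟨ tabulate-cong (classify-admissible adm) ⟩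
    tabulate (lookup ℓ)                       ≡⟨ tabulate∘lookup ℓ ⟩
    ℓ ∎
    where open ≡-Reasoning

  solution⇒admissible : ∀ {p} → ConnectedSolution p → Admissible (labelling p) (centre p) p
  solution⇒admissible {X , Y} (idX , idY , comm , conn) = admissible (fixedY-point (idY (app X o))) rule
    where
    c = centre (X , Y)
    ℓ = labelling (X , Y)
    YX≡c : ∀ j → app Y (app X j) ≡ c
    YX≡c j = connected⇒YX-constant X Y idX idY comm conn j o
    XY≡c : ∀ j → app X (app Y j) ≡ c
    XY≡c j = trans (sym (comm j)) (YX≡c j)
    fixedY-point : ∀ {k} → app Y k ≡ k → lookup ℓ k ≡ fixedY
    fixedY-point {k} Yk≡k = trans (lookup∘tabulate _ k) (classify-fixedY X Y Yk≡k)
    fixedX-point : ∀ {k} → app Y k ≢ k → app X k ≡ k → lookup ℓ k ≡ fixedX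
    fixedX-point {k} Yk≢k Xk≡k = trans (lookup∘tabulate _ k) (classify-fixedX X Y Yk≢k Xk≡k)
    classified : ∀ j → Rule ℓ c (classify X Y c j) j (app X j) (app Y j)
    classified j with app Y j ≟ j | app X j ≟ j | app X j ≟ c
    ... | yes Yj≡j | _        | _        = trans (cong (app X) (sym Yj≡j)) (XY≡c j) , Yj≡j
    ... | no _     | yes Xj≡j | _        = Xj≡j , trans (cong (app Y) (sym Xj≡j)) (YX≡c j)
    ... | no _     | no _     | yes Xj≡c = Xj≡c , fixedY-point (idY j)
    ... | no _     | no _     | no Xj≢c  =
      fixedX-point (λ YXj≡Xj → Xj≢c (trans (sym YXj≡Xj) (YX≡c j))) (idX j) , fixedY-point (idY j)
    rule : ∀ j → Rule ℓ c (lookup ℓ j) j (app X j) (app Y j)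
    rule j = subst (λ L → Rule ℓ c L j (app X j) (app Y j)) (sym (lookup∘tabulate _ j)) (classified j)

-- Enumeration

xImages yImages : Vec Label n → Fin n → Label → Fin n → List (Fin n)
xImages ℓ c fixedX   j = [ j ]
xImages ℓ c fixedY   j = [ c ]
xImages ℓ c toCentre j = [ c ]
xImages ℓ c other    j = positions fixedX ℓ
yImages ℓ c fixedX   j = [ c ]
yImages ℓ c fixedY   j = [ j ]
yImages ℓ c toCentre j = positions fixedY ℓ
yImages ℓ c other    j = positions fixedY ℓ

module _ {ℓ : Vec Label n} {c j x y : Fin n} where

  ∈-images⁺ : ∀ L → Rule ℓ c L j x y → x ∈ xImages ℓ c L j × y ∈ yImages ℓ c L j
  ∈-images⁺ fixedX   (x≡j , y≡c) = here x≡j , here y≡c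
  ∈-images⁺ fixedY   (x≡c , y≡j) = here x≡c , here y≡j
  ∈-images⁺ toCentre (x≡c , ℓy)  = here x≡c , ∈-positions⁺ ℓ ℓy
  ∈-images⁺ other    (ℓx , ℓy)   = ∈-positions⁺ ℓ ℓx , ∈-positions⁺ ℓ ℓy

  ∈-images⁻ : ∀ L → x ∈ xImages ℓ c L j → y ∈ yImages ℓ c L j → Rule ℓ c L j x y
  ∈-images⁻ fixedX   x∈ y∈ = singleton⁻ x∈ , singleton⁻ y∈
  ∈-images⁻ fixedY   x∈ y∈ = singleton⁻ x∈ , singleton⁻ y∈
  ∈-images⁻ toCentre x∈ y∈ = singleton⁻ x∈ , ∈-positions⁻ ℓ y∈
  ∈-images⁻ other    x∈ y∈ = ∈-positions⁻ ℓ x∈ , ∈-positions⁻ ℓ y∈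

module _ (ℓ : Vec Label n) (c j : Fin n) where

  xImages-unique : ∀ L → Unique (xImages ℓ c L j)
  xImages-unique fixedX   = [] ∷ []
  xImages-unique fixedY   = [] ∷ []
  xImages-unique toCentre = [] ∷ []
  xImages-unique other    = positions-unique fixedX ℓ

  yImages-unique : ∀ L → Unique (yImages ℓ c L j)
  yImages-unique fixedX   = [] ∷ []
  yImages-unique fixedY   = [] ∷ []
  yImages-unique toCentre = positions-unique fixedY ℓ
  yImages-unique other    = positions-unique fixedY ℓ

xImageCount yImageCount : Vec ℕ 4 → Label → ℕ
xImageCount κ other    = lookup κ fixedX
xImageCount κ _        = 1
yImageCount κ toCentre = lookup κ fixedY
yImageCount κ other    = lookup κ fixedY
yImageCount κ _        = 1

module _ (ℓ : Vec Label n) (c j : Fin n) where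

  length-xImages : ∀ L → length (xImages ℓ c L j) ≡ xImageCount (census ℓ) L
  length-xImages fixedX   = refl
  length-xImages fixedY   = refl
  length-xImages toCentre = refl
  length-xImages other    = length-positions fixedX ℓ

  length-yImages : ∀ L → length (yImages ℓ c L j) ≡ yImageCount (census ℓ) L
  length-yImages fixedX   = refl
  length-yImages fixedY   = refl
  length-yImages toCentre = length-positions fixedY ℓ
  length-yImages other    = length-positions fixedY ℓ

xChoices yChoices : Vec Label n → Fin n → Fin n → List (Fin n)
xChoices ℓ c j = xImages ℓ c (lookup ℓ j) j
yChoices ℓ c j = yImages ℓ c (lookup ℓ j) j

admissiblePairs : Vec Label n → Fin n → List (T n × T n)
admissiblePairs ℓ c = cartesianProduct (choices (xChoices ℓ c)) (choices (yChoices ℓ c))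

module _ {ℓ : Vec Label n} {c : Fin n} where

  ∈-admissiblePairs⁺ : ∀ {p} → Admissible ℓ c p → p ∈ admissiblePairs ℓ c
  ∈-admissiblePairs⁺ (admissible _ rule) = ∈-cartesianProduct⁺
    (∈-choices⁺ (λ j → proj₁ (∈-images⁺ (lookup ℓ j) (rule j))))
    (∈-choices⁺ (λ j → proj₂ (∈-images⁺ (lookup ℓ j) (rule j))))

∈-admissiblePairs⁻ : (ℓ : Vec Label n) (c : Fin n) {p : T n × T n} →
  lookup ℓ c ≡ fixedY → p ∈ admissiblePairs ℓ c → Admissible ℓ c p
∈-admissiblePairs⁻ ℓ c ℓc p∈ with X∈ , Y∈ ← ∈-cartesianProduct⁻ _ _ p∈ =
  admissible ℓc (λ j → ∈-images⁻ (lookup ℓ j) (∈-choices⁻ X∈ j) (∈-choices⁻ Y∈ j))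

admissiblePairs-unique : (ℓ : Vec Label n) (c : Fin n) → Unique (admissiblePairs ℓ c)
admissiblePairs-unique ℓ c = cartesianProduct⁺
  (choices-unique (λ j → xImages-unique ℓ c j (lookup ℓ j)))
  (choices-unique (λ j → yImages-unique ℓ c j (lookup ℓ j)))

length-admissiblePairs : (ℓ : Vec Label n) (c : Fin n) {r s t m : ℕ} → census ℓ ≡ r ∷ s ∷ t ∷ m ∷ [] →
  length (admissiblePairs ℓ c) ≡ r ^ m * s ^ (t + m)
length-admissiblePairs ℓ c {r} {s} {t} {m} census≡ = begin
  length (admissiblePairs ℓ c)
    ≡⟨ length-cartesianProductWith _,_ (choices (xChoices ℓ c)) (choices (yChoices ℓ c)) ⟩
  length (choices (xChoices ℓ c)) * length (choices (yChoices ℓ c))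
    ≡⟨ cong₂ _*_ (length-choices (xChoices ℓ c)) (length-choices (yChoices ℓ c)) ⟩
  ∏ (length ∘ xChoices ℓ c) * ∏ (length ∘ yChoices ℓ c)
    ≡⟨ cong₂ _*_ (∏-cong (λ j → length-xImages ℓ c j (lookup ℓ j)))
                 (∏-cong (λ j → length-yImages ℓ c j (lookup ℓ j))) ⟩
  ∏ (xImageCount (census ℓ) ∘ lookup ℓ) * ∏ (yImageCount (census ℓ) ∘ lookup ℓ)
    ≡⟨ cong₂ _*_ (∏-lookup (xImageCount (census ℓ)) ℓ) (∏-lookup (yImageCount (census ℓ)) ℓ) ⟩
  powers (census ℓ)
    ≡⟨ cong powers census≡ ⟩
  (1 ^ r * (1 ^ s * (1 ^ t * (r ^ m * 1)))) * (1 ^ r * (1 ^ s * (s ^ t * (s ^ m * 1))))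
    ≡⟨ cong₂ _*_ xPowers yPowers ⟩
  r ^ m * s ^ (t + m) ∎
  where
  open ≡-Reasoning
  powers : Vec ℕ 4 → ℕ
  powers κ = ∏ (λ L → xImageCount κ L ^ lookup κ L) * ∏ (λ L → yImageCount κ L ^ lookup κ L)
  xPowers : 1 ^ r * (1 ^ s * (1 ^ t * (r ^ m * 1))) ≡ r ^ m
  xPowers rewrite ^-zeroˡ r | ^-zeroˡ s | ^-zeroˡ t =
    trans (*-identityˡ _) (trans (*-identityˡ _) (trans (*-identityˡ _) (*-identityʳ _)))
  yPowers : 1 ^ r * (1 ^ s * (s ^ t * (s ^ m * 1))) ≡ s ^ (t + m)
  yPowers rewrite ^-zeroˡ r | ^-zeroˡ s | *-identityʳ (s ^ m) =
    trans (*-identityˡ _) (trans (*-identityˡ _) (sym (^-distribˡ-+-* s t m)))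

Profile : Set
Profile = ℕ × ℕ × ℕ

-- If r + s + t > n, truncated subtraction makes the census sum differ from n, so no word has
-- this census (arrangementsOfProfile-empty), as the summand of formula vanishes too.
censusOfProfile : ℕ → Profile → Vec ℕ 4
censusOfProfile n (r , s , t) = r ∷ s ∷ t ∷ n ∸ r ∸ s ∸ t ∷ []

profileOf : Vec ℕ 4 → Profile
profileOf κ = lookup κ fixedX , lookup κ fixedY , lookup κ toCentre

∑-censusOfProfile : ∀ n r s t → ∑ (lookup (censusOfProfile n (r , s , t))) ≡ r + s + t + (n ∸ r ∸ s ∸ t)
∑-censusOfProfile n r s t = reassociate r s t (n ∸ r ∸ s ∸ t)
  where
  reassociate : ∀ r s t m → r + (s + (t + (m + 0))) ≡ r + s + t + m
  reassociate = solve-∀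

censusOfProfile-profileOf : ∀ n (κ : Vec ℕ 4) → ∑ (lookup κ) ≡ n → censusOfProfile n (profileOf κ) ≡ κ
censusOfProfile-profileOf n (r ∷ s ∷ t ∷ m ∷ []) ∑κ≡n = cong (λ k → r ∷ s ∷ t ∷ k ∷ []) (begin
  n ∸ r ∸ s ∸ t                          ≡⟨ cong (λ k → k ∸ r ∸ s ∸ t) ∑κ≡n ⟨
  r + (s + (t + (m + 0))) ∸ r ∸ s ∸ t    ≡⟨ cong (λ k → k ∸ s ∸ t) (m+n∸m≡n r _) ⟩
  s + (t + (m + 0)) ∸ s ∸ t              ≡⟨ cong (_∸ t) (m+n∸m≡n s _) ⟩
  t + (m + 0) ∸ t                        ≡⟨ m+n∸m≡n t _ ⟩
  m + 0                                  ≡⟨ +-identityʳ m ⟩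
  m ∎)
  where open ≡-Reasoning

module _ (n r s t : ℕ) where

  private m = n ∸ r ∸ s ∸ t

  arrangementsOfProfile-empty : ¬ (r + s + t ≤ n) → arrangements n (censusOfProfile n (r , s , t)) ≡ []
  arrangementsOfProfile-empty r+s+t≰n = arrangements-empty n _ λ ∑≡n →
    r+s+t≰n (≤-trans (m≤m+n (r + s + t) m) (≤-reflexive (trans (sym (∑-censusOfProfile n r s t)) ∑≡n)))

  module _ (r+s+t≤n : r + s + t ≤ n) where

    profile-total : r + s + t + m ≡ n
    profile-total = begin
      r + s + t + (n ∸ r ∸ s ∸ t)
        ≡⟨ cong (r + s + t +_) (trans (cong (_∸ t) (∸-+-assoc n r s)) (∸-+-assoc n (r + s) t)) ⟩
      r + s + t + (n ∸ (r + s + t))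
        ≡⟨ m+[n∸m]≡n r+s+t≤n ⟩
      n ∎
      where open ≡-Reasoning

    profile-remainder : n ∸ r ∸ s ≡ t + m
    profile-remainder = begin
      n ∸ r ∸ s                  ≡⟨ cong (λ k → k ∸ r ∸ s) profile-total ⟨
      r + s + t + m ∸ r ∸ s      ≡⟨ cong (λ k → k ∸ r ∸ s) (reassociate r s t m) ⟩
      r + (s + (t + m)) ∸ r ∸ s  ≡⟨ cong (_∸ s) (m+n∸m≡n r _) ⟩
      s + (t + m) ∸ s            ≡⟨ m+n∸m≡n s _ ⟩
      t + m ∎
      where
      open ≡-Reasoning
      reassociate : ∀ r s t m → r + s + t + m ≡ r + (s + (t + m))
      reassociate = solve-∀

    length-arrangementsOfProfile : length (arrangements n (censusOfProfile n (r , s , t))) ≡ multinomial n r s t m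
    length-arrangementsOfProfile = begin
      length words          ≡⟨ m*n/n≡m (length words) D ⟨
      length words * D / D  ≡⟨ cong (_/ D) words-times-D ⟩
      n ! / D ∎
      where
      open ≡-Reasoning
      words = arrangements n (censusOfProfile n (r , s , t))
      D = (r ! * s !) * (t ! * m !)
      instance
        D≢0 : NonZero D
        D≢0 = m*n≢0 (r ! * s !) (t ! * m !) {{r !* s !≢0}} {{t !* m !≢0}}
      regroup : ∀ a b c d → a * (b * (c * (d * 1))) ≡ (a * b) * (c * d)
      regroup = solve-∀
      words-times-D : length words * D ≡ n !
      words-times-D = begin
        length words * D
          ≡⟨ cong (length words *_) (regroup (r !) (s !) (t !) (m !)) ⟨
        length words * factorialProduct (censusOfProfile n (r , s , t))
          ≡⟨ length-arrangements n _ (trans (∑-censusOfProfile n r s t) profile-total) ⟩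
        n ! ∎

module Enumeration (o : Fin n) where

  open Classification o

  solutionsWith : Vec Label n → List (T n × T n)
  solutionsWith ℓ = concatMap (admissiblePairs ℓ) (positions fixedY ℓ)

  ∈-solutionsWith⁺ : ∀ {ℓ c p} → Admissible ℓ c p → p ∈ solutionsWith ℓ
  ∈-solutionsWith⁺ {ℓ} adm =
    ∈-concatMap⁺ (admissiblePairs ℓ)
      (lose (∈-positions⁺ ℓ (Admissible.centre-fixedY adm)) (∈-admissiblePairs⁺ adm))

  ∈-solutionsWith⁻ : ∀ ℓ {p} → p ∈ solutionsWith ℓ → Σ (Fin n) λ c → Admissible ℓ c p
  ∈-solutionsWith⁻ ℓ p∈ with c , c∈ , p∈c ← find (∈-concatMap⁻ (admissiblePairs ℓ) p∈) =
    c , ∈-admissiblePairs⁻ ℓ _ (∈-positions⁻ ℓ c∈) p∈c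

  solutionsWith-unique : ∀ ℓ → Unique (solutionsWith ℓ)
  solutionsWith-unique ℓ = concatMap-unique centre (positions-unique fixedY ℓ)
    (λ {c} _ → admissiblePairs-unique ℓ c)
    (λ c∈ p∈ → admissible⇒centre (∈-admissiblePairs⁻ ℓ _ (∈-positions⁻ ℓ c∈) p∈))

  length-solutionsWith : ∀ ℓ {r s t m} → census ℓ ≡ r ∷ s ∷ t ∷ m ∷ [] →
    length (solutionsWith ℓ) ≡ s * (r ^ m * s ^ (t + m))
  length-solutionsWith ℓ census≡ = trans
    (length-concatMap-uniform (admissiblePairs ℓ) (positions fixedY ℓ) (λ {c} _ → length-admissiblePairs ℓ c census≡))
    (cong (_* _) (trans (length-positions fixedY ℓ) (cong (λ κ → lookup κ fixedY) census≡)))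

  solutionsOfProfile : Profile → List (T n × T n)
  solutionsOfProfile τ = concatMap solutionsWith (arrangements n (censusOfProfile n τ))

  profileOfSolution : T n × T n → Profile
  profileOfSolution = profileOf ∘ census ∘ labelling

  solutionsOfProfile-unique : ∀ τ → Unique (solutionsOfProfile τ)
  solutionsOfProfile-unique τ = concatMap-unique labelling (arrangements-unique n _)
    (λ {ℓ} _ → solutionsWith-unique ℓ)
    (λ {ℓ} _ p∈ → admissible⇒labelling (proj₂ (∈-solutionsWith⁻ ℓ p∈)))

  ∈-solutionsOfProfile⁻ : ∀ {τ p} → p ∈ solutionsOfProfile τ → profileOfSolution p ≡ τ
  ∈-solutionsOfProfile⁻ {r , s , t} p∈ with ℓ , ℓ∈ , p∈ℓ ← find (∈-concatMap⁻ solutionsWith p∈) = begin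
    profileOf (census (labelling _))
      ≡⟨ cong (profileOf ∘ census) (admissible⇒labelling (proj₂ (∈-solutionsWith⁻ ℓ p∈ℓ))) ⟩
    profileOf (census ℓ)
      ≡⟨ cong profileOf (∈-arrangements⁻ n _ ℓ∈) ⟩
    (r , s , t) ∎
    where open ≡-Reasoning

  length-solutionsOfProfile : ∀ r s t → length (solutionsOfProfile (r , s , t)) ≡ term n r s t
  length-solutionsOfProfile r s t with r + s + t ≤ᵇ n in ≤ᵇ≡
  ... | false = cong (length ∘ concatMap solutionsWith)
                     (arrangementsOfProfile-empty n r s t (λ r+s+t≤n → subst Bool.T ≤ᵇ≡ (≤⇒≤ᵇ r+s+t≤n)))
  ... | true  = begin
    length (concatMap solutionsWith words)
      ≡⟨ length-concatMap-uniform solutionsWith words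
           (λ {ℓ} ℓ∈ → length-solutionsWith ℓ (∈-arrangements⁻ n _ ℓ∈)) ⟩
    length words * (s * (r ^ m * s ^ (t + m)))
      ≡⟨ cong (_* (s * (r ^ m * s ^ (t + m)))) (length-arrangementsOfProfile n r s t r+s+t≤n) ⟩
    M * (s * (r ^ m * s ^ (t + m)))
      ≡⟨ reorder M s (r ^ m) (s ^ (t + m)) ⟩
    M * r ^ m * (s ^ (t + m) * s ^ 1)
      ≡⟨ cong (M * r ^ m *_) (^-distribˡ-+-* s (t + m) 1) ⟨
    M * r ^ m * s ^ (t + m + 1)
      ≡⟨ cong (λ k → M * r ^ m * s ^ (k + 1)) (profile-remainder n r s t r+s+t≤n) ⟨
    M * r ^ m * s ^ (n ∸ r ∸ s + 1) ∎
    where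
    open ≡-Reasoning
    m = n ∸ r ∸ s ∸ t
    M = multinomial n r s t m
    words = arrangements n (censusOfProfile n (r , s , t))
    r+s+t≤n : r + s + t ≤ n
    r+s+t≤n = ≤ᵇ⇒≤ (r + s + t) n (subst Bool.T (sym ≤ᵇ≡) tt)
    reorder : ∀ M s a b → M * (s * (a * b)) ≡ M * a * (b * (s * 1))
    reorder = solve-∀

  range : List ℕ
  range = upTo (suc n)

  profiles : List Profile
  profiles = cartesianProduct range (cartesianProduct range range)

  solutions : List (T n × T n)
  solutions = concatMap solutionsOfProfile profiles

  solutions-unique : Unique solutions
  solutions-unique = concatMap-unique profileOfSolution
    (cartesianProduct⁺ (upTo⁺ (suc n)) (cartesianProduct⁺ (upTo⁺ (suc n)) (upTo⁺ (suc n))))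
    (λ {τ} _ → solutionsOfProfile-unique τ)
    (λ _ → ∈-solutionsOfProfile⁻)

  length-solutions : length solutions ≡ formula n
  length-solutions = begin
    length solutions
      ≡⟨ length-concatMap solutionsOfProfile profiles ⟩
    sum (map (length ∘ solutionsOfProfile) profiles)
      ≡⟨ cong sum (map-cong (λ (r , s , t) → length-solutionsOfProfile r s t) profiles) ⟩
    sum (map (λ (r , s , t) → term n r s t) profiles)
      ≡⟨ sum-map-cartesianProduct (λ (r , s , t) → term n r s t) range (cartesianProduct range range) ⟩
    sum (map (λ r → sum (map (λ (s , t) → term n r s t) (cartesianProduct range range))) range)
      ≡⟨ cong sum (map-cong (λ r → sum-map-cartesianProduct (λ (s , t) → term n r s t) range range) range) ⟩
    formula n ∎
    where open ≡-Reasoning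

  ∈-solutions⁻ : ∀ {p} → p ∈ solutions → ConnectedSolution p
  ∈-solutions⁻ {X , Y} p∈
    with τ , _ , p∈τ ← find (∈-concatMap⁻ solutionsOfProfile {xs = profiles} p∈)
    with ℓ , _ , p∈ℓ ← find (∈-concatMap⁻ solutionsWith {xs = arrangements n (censusOfProfile n τ)} p∈τ)
    = Admissibility.solution (proj₂ (∈-solutionsWith⁻ ℓ p∈ℓ))

  ∈-solutions⁺ : ∀ {p} → ConnectedSolution p → p ∈ solutions
  ∈-solutions⁺ {p} sol = ∈-concatMap⁺ solutionsOfProfile {xs = profiles}
    (lose profile∈ (∈-concatMap⁺ solutionsWith (lose ℓ∈ (∈-solutionsWith⁺ (solution⇒admissible sol)))))
    where
    ℓ = labelling p
    profile∈ : profileOfSolution p ∈ profiles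
    profile∈ = ∈-cartesianProduct⁺ (bounded fixedX) (∈-cartesianProduct⁺ (bounded fixedY) (bounded toCentre))
      where
      bounded : ∀ L → lookup (census ℓ) L ∈ range
      bounded L = ∈-upTo⁺ (s≤s (subst (_≤ n) (sym (lookup-census ℓ L)) (count≤n (_≟ L) ℓ)))
    ℓ∈ : ℓ ∈ arrangements n (censusOfProfile n (profileOfSolution p))
    ℓ∈ = subst (λ κ → ℓ ∈ arrangements n κ)
               (sym (censusOfProfile-profileOf n (census ℓ) (∑-census ℓ))) (∈-arrangements⁺ ℓ)

theorem7 : (n : ℕ) → n ≥ 1 →
    Σ (List (T n × T n)) λ L →
      Unique L × length L ≡ formula n ×
      ((p : T n × T n) → (p ∈ L) ⇔ ConnectedSolution p)
theorem7 (suc n) _ = solutions , solutions-unique , length-solutions , λ p → mk⇔ ∈-solutions⁻ ∈-solutions⁺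
  where open Enumeration {suc n} zero
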